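{- Let $n\ge 3$ and let $S=\{(i\ \ i+1\ \ i+2): 1\le i\le n-2\}$, a generating set of the alternating group $A_n$. Then the $G$-graph $\Gamma(A_n,S)$ is $(n-2)$-partite (its vertex set is partitioned into the $n-2$ classes $V_s$, $s\in S$, each containing no edge), $3(n-3)$-regular, has $|E|=\frac{n!(n-2)(n-3)}{4}$ edges and $|V|=\frac{n!(n-2)}{6}$ vertices.
   Context: For a group $G$ generated by a finite set $S$, the $G$-graph $\Gamma(G,S)$ has vertex set the disjoint union over $s\in S$ of the sets $V_s$ of right cosets $\langle s\rangle x$ ($x\in G$) of the cyclic subgroup $\langle s\rangle$; for $s\neq t$ in $S$, $\langle s\rangle x$ and $\langle t\rangle y$ are joined by exactly $|\langle s\rangle x\cap\langle t\rangle y|$ parallel edges; vertices in the same $V_s$ are non-adjacent and there are no loops. Degrees and edges counted with multiplicity. -}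

module Defs where

open import Data.Nat using (ℕ; zero; suc; _+_; _*_; _∸_; _<ᵇ_; _%_)
open import Data.Bool using (Bool; true; false; if_then_else_; _∧_; not)
open import Data.Bool.Properties using () renaming (_≟_ to _≟𝔹_)
open import Data.Fin using (Fin; zero; suc; toℕ; inject₁; _≟_)
open import Data.Vec using (Vec; []; _∷_; lookup; tabulate)
open import Data.Vec.Properties using (≡-dec)
open import Data.List using (List; []; _∷_; map; concatMap; filterᵇ; deduplicateᵇ;
  length; allFin; upTo)
open import Data.Nat.ListAction using (sum)
open import Data.Bool.ListAction using (any; all)
open import Relation.Nullary using (does)
open import Function using (id)

-- Permutations of Fin n in one-line notation: σ(i) = lookup σ i.

Perm : ℕ → Set
Perm n = Vec (Fin n) n

words : (n k : ℕ) → List (Vec (Fin n) k)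
words n zero    = [] ∷ []
words n (suc k) = concatMap (λ a → map (a ∷_) (words n k)) (allFin n)

_=ᶠ_ : ∀ {n} → Fin n → Fin n → Bool
a =ᶠ b = does (a ≟ b)

_=ᵖ_ : ∀ {n} → Perm n → Perm n → Bool
σ =ᵖ τ = does (≡-dec _≟_ σ τ)

_=ᵇ_ : Bool → Bool → Bool
a =ᵇ b = does (a ≟𝔹 b)

isInjective : ∀ {n} → Perm n → Bool
isInjective {n} σ =
  all (λ i → all (λ j → not (toℕ i <ᵇ toℕ j) ∨' not (lookup σ i =ᶠ lookup σ j))
                 (allFin n)) (allFin n)
  where
  _∨'_ : Bool → Bool → Bool
  true  ∨' _ = true
  false ∨' b = b

inversions : ∀ {n} → Perm n → ℕ
inversions {n} σ =
  sum (map (λ i → length (filterᵇ (λ j → (toℕ i <ᵇ toℕ j) ∧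
                                          (toℕ (lookup σ j) <ᵇ toℕ (lookup σ i)))
                                  (allFin n)))
           (allFin n))

isEven : ∀ {n} → Perm n → Bool
isEven σ = (inversions σ % 2) =ⁿ 0
  where
  _=ⁿ_ : ℕ → ℕ → Bool
  zero  =ⁿ zero  = true
  zero  =ⁿ suc _ = false
  suc _ =ⁿ zero  = false
  suc a =ⁿ suc b = a =ⁿ b

Alt : (n : ℕ) → List (Perm n)
Alt n = filterᵇ (λ σ → isInjective σ ∧ isEven σ) (words n n)

_·_ : ∀ {n} → Perm n → Perm n → Perm n
σ · τ = tabulate (λ i → lookup σ (lookup τ i))

idPerm : ∀ {n} → Perm n
idPerm = tabulate id

_^^_ : ∀ {n} → Perm n → ℕ → Perm n
s ^^ zero  = idPerm
s ^^ suc k = s · (s ^^ k)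

module GGraph {n k : ℕ} (gen : Fin k → Perm n) where

  G : List (Perm n)
  G = Alt n

  -- the right coset ⟨s⟩x = { s^j x : j ∈ ℕ }, listed (possibly with
  -- repetitions) as s^j x for j < |G| (which exhausts ⟨s⟩)
  coset : Fin k → Perm n → List (Perm n)
  coset s x = map (λ j → (gen s ^^ j) · x) (upTo (length G))

  _∈ᵇ_ : Perm n → List (Perm n) → Bool
  g ∈ᵇ C = any (g =ᵖ_) C

  sameCoset : Fin k → Perm n → Perm n → Bool
  sameCoset s x y = all (λ g → (g ∈ᵇ coset s x) =ᵇ (g ∈ᵇ coset s y)) G

  -- V_s : one representative x ∈ G for each distinct right coset ⟨s⟩x.
  -- The vertex set is the disjoint union of the V_s; a vertex is a pair
  -- (s , x) with x ∈ reps s, standing for the coset ⟨s⟩x ∈ V_s.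
  reps : Fin k → List (Perm n)
  reps s = deduplicateᵇ (sameCoset s) G

  meet : Fin k → Perm n → Fin k → Perm n → ℕ
  meet s x t y = length (filterᵇ (λ g → (g ∈ᵇ coset s x) ∧ (g ∈ᵇ coset t y)) G)

  -- number of (parallel) edges between vertices (s,x) and (t,y):
  -- 0 inside a class V_s, |⟨s⟩x ∩ ⟨t⟩y| between different classes
  mult : Fin k → Perm n → Fin k → Perm n → ℕ
  mult s x t y = if s =ᶠ t then 0 else meet s x t y

  degree : Fin k → Perm n → ℕ
  degree s x = sum (map (λ t → sum (map (λ y → mult s x t y) (reps t))) (allFin k))

  vertexCount : ℕ
  vertexCount = sum (map (λ s → length (reps s)) (allFin k))

  edgeCount : ℕ
  edgeCount =
    sum (map (λ s → sum (map (λ t →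
      if toℕ s <ᵇ toℕ t
      then sum (map (λ x → sum (map (λ y → mult s x t y) (reps t))) (reps s))
      else 0) (allFin k))) (allFin k))

-- The generators (i i+1 i+2), 0-indexed i = 0 … n-3, for n = 3 + m.

threeCycle : (m : ℕ) → Fin (suc m) → Perm (3 + m)
threeCycle m i = tabulate f
  where
  a b c : Fin (3 + m)
  a = inject₁ (inject₁ i)
  b = suc (inject₁ i)
  c = suc (suc i)
  f : Fin (3 + m) → Fin (3 + m)
  f j = if j =ᶠ a then b else if j =ᶠ b then c else if j =ᶠ c then a else j

-- A three-cycle γ = (i i+1 i+2) is even: on values it rotates A ↦ A+1 ↦ A+2 ↦ A, which reverses
-- the relative order of exactly the two value pairs {A+1, A+2} and {A, A+2}, so it changes the
-- inversion count by an even number.  Hence γ maps Aₙ to itself and the cosets ⟨γ⟩x are the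
-- orbits {x, γx, γ²x}, each of size 3.  Swapping the first two letters exchanges the even and the
-- odd injective words, so |Aₙ| = n!/2 and every class V_s has n!/6 vertices.  For s ≠ t every
-- element of ⟨s⟩x lies in exactly one coset ⟨t⟩y, so the multiplicities of the edges from ⟨s⟩x
-- into V_t add up to |⟨s⟩x| = 3.  Summing over the n − 3 classes t ≠ s gives the degree 3(n − 3),
-- and summing over the (n − 2)(n − 3)/2 pairs of classes, each joined by 3 · n!/6 edges, gives |E|.

module Submission where

open import Defs
open import Data.Nat using (ℕ; zero; suc; _+_; _*_; _∸_; _!; _%_; _<_; _≤_; _<ᵇ_; _≡ᵇ_; s≤s; z≤n)
open import Data.Nat.Properties
  using (+-identityʳ; +-assoc; +-comm; +-cancelʳ-≡; *-identityˡ; *-identityʳ; *-zeroʳ; *-suc; *-comm; *-assoc;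
         *-distribˡ-+; *-cancelˡ-≤; m+n∸n≡m; ≤-refl; ≤-trans; m≤n*m; <-irrefl; <-cmp; n<1+n; 1+n≢n; m≢1+n+m;
         <⇒<ᵇ; <ᵇ⇒<; ≤⇒≤ᵇ; ≡ᵇ⇒≡; ≡⇒≡ᵇ)
  renaming (suc-injective to ℕ-suc-injective)
open import Data.Nat.ListAction using (sum)
open import Data.Nat.Tactic.RingSolver using (solve-∀)
open import Data.Nat.Combinatorics using (nPn≡n!)
open import Data.Nat.Combinatorics.Base using (_P′_)
open import Data.Bool using (Bool; true; false; _∧_; _∨_; not; T; T?; if_then_else_)
open import Data.Bool.Properties using (T-∧; ∧-identityʳ; ∧-zeroʳ; not-involutive) renaming (_≟_ to _≟𝔹_)
open import Data.Bool.ListAction using (any; all)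
open import Data.Empty using (⊥-elim)
open import Data.Unit using (tt)
open import Data.Fin using (Fin; zero; suc; toℕ; _≟_; inject₁; punchOut)
open import Data.Fin.Properties using (toℕ-injective; suc-injective; toℕ-inject₁; any?; pigeonhole; punchOut-injective; ¬∀⟶∃¬)
open import Data.Vec using (Vec; []; _∷_; lookup; tabulate)
open import Data.Vec.Properties using (≡-dec; lookup∘tabulate; tabulate∘lookup; tabulate-cong)
open import Data.List as List using (List; []; _∷_; map; concatMap; filter; filterᵇ; deduplicateᵇ; length; allFin; _++_)
import Data.List.Properties as Listₚ
open import Data.List.Membership.Propositional using (_∈_)
open import Data.List.Membership.Propositional.Properties using (∈-allFin; ∈-map⁺; ∈-map⁻; ∈-upTo⁺; ∈-filter⁻; ∈-deduplicate⁻)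
open import Data.List.Relation.Unary.Any as Any using (here; there)
open import Data.List.Relation.Unary.Any.Properties using (any⁺; any⁻)
import Data.List.Relation.Unary.All as All
open import Data.List.Relation.Unary.All.Properties using (all⁺; all⁻)
open import Data.List.Relation.Unary.Unique.Propositional using (Unique; []; _∷_)
open import Data.Product using (∃; ∃₂; _×_; _,_; proj₁; proj₂)
open import Relation.Nullary using (¬_; Dec; yes; no; does; ¬?)
open import Relation.Nullary.Decidable using (dec-true)
open import Relation.Unary using (Decidable)
open import Relation.Binary using (tri<; tri≈; tri>)
open import Relation.Binary.PropositionalEquality
open import Function using (_∘_; id; case_of_)
open import Function.Bundles using (Equivalence)
open import Function.Definitions using (Injective)

-- Indicators and finite sums

⟦_⟧ : Bool → ℕ
⟦ true ⟧  = 1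
⟦ false ⟧ = 0

⟦∧⟧ : ∀ a b → ⟦ a ∧ b ⟧ ≡ ⟦ a ⟧ * ⟦ b ⟧
⟦∧⟧ true  b = sym (+-identityʳ ⟦ b ⟧)
⟦∧⟧ false b = refl

⟦not⟧+⟦⟧ : ∀ b → ⟦ not b ⟧ + ⟦ b ⟧ ≡ 1
⟦not⟧+⟦⟧ true  = refl
⟦not⟧+⟦⟧ false = refl

does-sound : ∀ {P : Set} (d : Dec P) → T (does d) → P
does-sound (yes p) _ = p

does-complete : ∀ {P : Set} (d : Dec P) → P → T (does d)
does-complete (yes _) _ = _
does-complete (no ¬p) p = ¬p p

T-ext : ∀ {a b} → (T a → T b) → (T b → T a) → a ≡ b
T-ext {true}  {true}  _ _ = refl
T-ext {true}  {false} f _ = ⊥-elim (f _)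
T-ext {false} {true}  _ g = ⊥-elim (g _)
T-ext {false} {false} _ _ = refl

true⇒T : ∀ {b} → b ≡ true → T b
true⇒T refl = _

T⇒true : ∀ {b} → T b → b ≡ true
T⇒true {true} _ = refl

∑ : {A : Set} → (A → ℕ) → List A → ℕ
∑ f xs = sum (map f xs)

syntax ∑ (λ x → e) xs = ∑[ x ∈ xs ] e

module _ {A : Set} where

  ∑-cong : {f g : A → ℕ} (xs : List A) → (∀ x → f x ≡ g x) → ∑ f xs ≡ ∑ g xs
  ∑-cong []       f≗g = refl
  ∑-cong (x ∷ xs) f≗g = cong₂ _+_ (f≗g x) (∑-cong xs f≗g)

  ∑-cong-∈ : {f g : A → ℕ} (xs : List A) → (∀ x → x ∈ xs → f x ≡ g x) → ∑ f xs ≡ ∑ g xs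
  ∑-cong-∈ []       f≗g = refl
  ∑-cong-∈ (x ∷ xs) f≗g = cong₂ _+_ (f≗g x (here refl)) (∑-cong-∈ xs (λ y y∈xs → f≗g y (there y∈xs)))

  ∑-distrib-+ : (f g : A → ℕ) (xs : List A) → ∑[ x ∈ xs ] (f x + g x) ≡ ∑ f xs + ∑ g xs
  ∑-distrib-+ f g []       = refl
  ∑-distrib-+ f g (x ∷ xs) = trans (cong (f x + g x +_) (∑-distrib-+ f g xs)) (interchange (f x) (g x) _ _)
    where
    interchange : ∀ a b c d → (a + b) + (c + d) ≡ (a + c) + (b + d)
    interchange = solve-∀

  ∑-*ˡ : (c : ℕ) (f : A → ℕ) (xs : List A) → ∑[ x ∈ xs ] (c * f x) ≡ c * ∑ f xs
  ∑-*ˡ c f []       = sym (*-zeroʳ c)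
  ∑-*ˡ c f (x ∷ xs) = trans (cong (c * f x +_) (∑-*ˡ c f xs)) (sym (*-distribˡ-+ c (f x) _))

  ∑-*ʳ : (c : ℕ) (f : A → ℕ) (xs : List A) → ∑[ x ∈ xs ] (f x * c) ≡ ∑ f xs * c
  ∑-*ʳ c f xs = trans (∑-cong xs (λ x → *-comm (f x) c)) (trans (∑-*ˡ c f xs) (*-comm c _))

  ∑-const : (c : ℕ) (xs : List A) → ∑[ x ∈ xs ] c ≡ c * length xs
  ∑-const c []       = sym (*-zeroʳ c)
  ∑-const c (x ∷ xs) = trans (cong (c +_) (∑-const c xs)) (sym (*-suc c _))

  ∑-zero : (xs : List A) → ∑[ x ∈ xs ] 0 ≡ 0
  ∑-zero xs = ∑-const 0 xs

  length≡∑1 : (xs : List A) → length xs ≡ ∑[ x ∈ xs ] 1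
  length≡∑1 xs = sym (trans (∑-const 1 xs) (*-identityˡ (length xs)))

  ∑-++ : (f : A → ℕ) (xs ys : List A) → ∑ f (xs ++ ys) ≡ ∑ f xs + ∑ f ys
  ∑-++ f []       ys = refl
  ∑-++ f (x ∷ xs) ys = trans (cong (f x +_) (∑-++ f xs ys)) (sym (+-assoc (f x) _ _))

  ∑-filter : {P : A → Set} (P? : Decidable P) (f : A → ℕ) (xs : List A) →
    ∑ f (filter P? xs) ≡ ∑[ x ∈ xs ] (⟦ does (P? x) ⟧ * f x)
  ∑-filter P? f []       = refl
  ∑-filter P? f (x ∷ xs) with does (P? x)
  ... | true  = cong₂ _+_ (sym (+-identityʳ (f x))) (∑-filter P? f xs)
  ... | false = ∑-filter P? f xs

  length-filterᵇ : (p : A → Bool) (xs : List A) → length (filterᵇ p xs) ≡ ∑[ x ∈ xs ] ⟦ p x ⟧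
  length-filterᵇ p xs = begin
    length (filterᵇ p xs)        ≡⟨ length≡∑1 (filterᵇ p xs) ⟩
    ∑[ x ∈ filterᵇ p xs ] 1       ≡⟨ ∑-filter (T? ∘ p) (λ _ → 1) xs ⟩
    ∑[ x ∈ xs ] (⟦ p x ⟧ * 1)    ≡⟨ ∑-cong xs (λ x → *-identityʳ ⟦ p x ⟧) ⟩
    ∑[ x ∈ xs ] ⟦ p x ⟧          ∎
    where open ≡-Reasoning

  ∑-complement : (p : A → Bool) (xs : List A) →
    ∑[ x ∈ xs ] ⟦ not (p x) ⟧ + ∑[ x ∈ xs ] ⟦ p x ⟧ ≡ length xs
  ∑-complement p xs = begin
    ∑[ x ∈ xs ] ⟦ not (p x) ⟧ + ∑[ x ∈ xs ] ⟦ p x ⟧ ≡⟨ ∑-distrib-+ _ _ xs ⟨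
    ∑[ x ∈ xs ] (⟦ not (p x) ⟧ + ⟦ p x ⟧)           ≡⟨ ∑-cong xs (λ x → ⟦not⟧+⟦⟧ (p x)) ⟩
    ∑[ x ∈ xs ] 1                                    ≡⟨ length≡∑1 xs ⟨
    length xs                                        ∎
    where open ≡-Reasoning

module _ {A B : Set} where

  ∑-map : (f : B → ℕ) (g : A → B) (xs : List A) → ∑ f (map g xs) ≡ ∑ (f ∘ g) xs
  ∑-map f g []       = refl
  ∑-map f g (x ∷ xs) = cong (f (g x) +_) (∑-map f g xs)

  ∑-concatMap : (f : B → ℕ) (g : A → List B) (xs : List A) →
    ∑ f (concatMap g xs) ≡ ∑[ x ∈ xs ] ∑ f (g x)
  ∑-concatMap f g []       = refl
  ∑-concatMap f g (x ∷ xs) = trans (∑-++ f (g x) (concatMap g xs)) (cong (∑ f (g x) +_) (∑-concatMap f g xs))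

  ∑-comm : (h : A → B → ℕ) (xs : List A) (ys : List B) →
    ∑[ x ∈ xs ] ∑[ y ∈ ys ] h x y ≡ ∑[ y ∈ ys ] ∑[ x ∈ xs ] h x y
  ∑-comm h []       ys = sym (∑-zero ys)
  ∑-comm h (x ∷ xs) ys = trans (cong (∑ (h x) ys +_) (∑-comm h xs ys))
    (sym (∑-distrib-+ (h x) (λ y → ∑[ x ∈ xs ] h x y) ys))

module _ {A : Set} (O : A → A → Bool)
         (O-sym : ∀ {a b} → T (O a b) → T (O b a))
         (O-trans : ∀ {a b c} → T (O a b) → T (O b c) → T (O a c)) where

  -- deduplicate keeps exactly one representative of every O-class met in the list.
  ∑-deduplicateᵇ : (R : A → A → Bool) (xs : List A) → (∀ a {b} → b ∈ xs → R a b ≡ O a b) →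
    ∀ g → ∑[ r ∈ deduplicateᵇ R xs ] ⟦ O r g ⟧ ≡ ⟦ any (λ l → O l g) xs ⟧
  ∑-deduplicateᵇ R []       R≡O g = refl
  ∑-deduplicateᵇ R (x ∷ xs) R≡O g =
    trans (cong (⟦ O x g ⟧ +_) (∑-filter (λ r → ¬? (T? (R x r))) (λ r → ⟦ O r g ⟧) D)) (split (O x g) refl)
    where
    D : List A
    D = deduplicateᵇ R xs
    R≡O-D : ∀ {r} → r ∈ D → R x r ≡ O x r
    R≡O-D r∈D = R≡O x (there (∈-deduplicate⁻ _ xs r∈D))
    split : ∀ b → O x g ≡ b →
      ⟦ b ⟧ + ∑[ r ∈ D ] (⟦ not (R x r) ⟧ * ⟦ O r g ⟧) ≡ ⟦ b ∨ any (λ l → O l g) xs ⟧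
    split true  xg = cong suc (trans (∑-cong-∈ D dropped) (∑-zero D))
      where
      dropped : ∀ r → r ∈ D → ⟦ not (R x r) ⟧ * ⟦ O r g ⟧ ≡ 0
      dropped r r∈D rewrite R≡O-D r∈D with O r g in rg
      ... | false = *-zeroʳ ⟦ not (O x r) ⟧
      ... | true with O x r in xr
      ...   | true  = refl
      ...   | false = case subst T xr (O-trans (true⇒T xg) (O-sym (true⇒T rg))) of λ ()
    split false xg = trans (∑-cong-∈ D kept) (∑-deduplicateᵇ R xs (λ a b∈xs → R≡O a (there b∈xs)) g)
      where
      kept : ∀ r → r ∈ D → ⟦ not (R x r) ⟧ * ⟦ O r g ⟧ ≡ ⟦ O r g ⟧
      kept r r∈D rewrite R≡O-D r∈D with O r g in rg
      ... | false = *-zeroʳ ⟦ not (O x r) ⟧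
      ... | true with O x r in xr
      ...   | false = refl
      ...   | true  = case subst T xg (O-trans (true⇒T xr) (true⇒T rg)) of λ ()

∑-allFin-suc : ∀ {n} (f : Fin (suc n) → ℕ) → ∑ f (allFin (suc n)) ≡ f zero + ∑ (f ∘ suc) (allFin n)
∑-allFin-suc f = cong (λ xs → f zero + sum xs) (trans (Listₚ.map-tabulate suc f) (sym (Listₚ.map-tabulate id (f ∘ suc))))

∑-allFin≡sum-tabulate : ∀ {n} (f : Fin n → ℕ) → ∑ f (allFin n) ≡ sum (List.tabulate f)
∑-allFin≡sum-tabulate f = cong sum (Listₚ.map-tabulate id f)

length-allFin : ∀ n → length (allFin n) ≡ n
length-allFin n = Listₚ.length-tabulate id

∑-allFin-1 : ∀ n → ∑[ i ∈ allFin n ] 1 ≡ n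
∑-allFin-1 n = trans (sym (length≡∑1 (allFin n))) (length-allFin n)

∑-δ : ∀ {n} (f : Fin n → ℕ) (i : Fin n) → ∑[ j ∈ allFin n ] (⟦ j =ᶠ i ⟧ * f j) ≡ f i
∑-δ {suc n} f zero    = trans (∑-allFin-suc (λ j → ⟦ j =ᶠ zero ⟧ * f j))
  (trans (cong₂ _+_ (+-identityʳ (f zero)) (∑-zero (allFin n))) (+-identityʳ (f zero)))
∑-δ {suc n} f (suc i) = trans (∑-allFin-suc (λ j → ⟦ j =ᶠ suc i ⟧ * f j)) (∑-δ (f ∘ suc) i)

∑-allFin-≟ : ∀ {n} (i : Fin n) → ∑[ j ∈ allFin n ] ⟦ j =ᶠ i ⟧ ≡ 1
∑-allFin-≟ {n} i = trans (∑-cong (allFin n) (λ j → sym (*-identityʳ ⟦ j =ᶠ i ⟧))) (∑-δ (λ _ → 1) i)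

=ᶠ-sym : ∀ {n} (a b : Fin n) → (a =ᶠ b) ≡ (b =ᶠ a)
=ᶠ-sym a b = T-ext (does-complete (b ≟ a) ∘ sym ∘ does-sound (a ≟ b))
                   (does-complete (a ≟ b) ∘ sym ∘ does-sound (b ≟ a))

=ᶠ≡≡ᵇ : ∀ {n} (a b : Fin n) → (a =ᶠ b) ≡ (toℕ a ≡ᵇ toℕ b)
=ᶠ≡≡ᵇ a b = T-ext (λ a≡b → ≡⇒≡ᵇ (toℕ a) (toℕ b) (cong toℕ (does-sound (a ≟ b) a≡b)))
                  (λ a≡ᵇb → does-complete (a ≟ b) (toℕ-injective (≡ᵇ⇒≡ (toℕ a) (toℕ b) a≡ᵇb)))

<ᵇ-irrefl : ∀ m → (m <ᵇ m) ≡ false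
<ᵇ-irrefl zero    = refl
<ᵇ-irrefl (suc m) = <ᵇ-irrefl m

<ᵇ≡not>ᵇ : ∀ {m n} → m ≢ n → (m <ᵇ n) ≡ not (n <ᵇ m)
<ᵇ≡not>ᵇ {zero}  {zero}  0≢0 = ⊥-elim (0≢0 refl)
<ᵇ≡not>ᵇ {zero}  {suc n} _   = refl
<ᵇ≡not>ᵇ {suc m} {zero}  _   = refl
<ᵇ≡not>ᵇ {suc m} {suc n} m≢n = <ᵇ≡not>ᵇ (m≢n ∘ cong suc)

trichotomy-indicator : ∀ {n} (i j : Fin n) → ⟦ toℕ i <ᵇ toℕ j ⟧ + ⟦ toℕ j <ᵇ toℕ i ⟧ + ⟦ j =ᶠ i ⟧ ≡ 1
trichotomy-indicator i j with j ≟ i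
... | yes refl rewrite <ᵇ-irrefl (toℕ i) = refl
... | no  j≢i  rewrite <ᵇ≡not>ᵇ {toℕ i} {toℕ j} (j≢i ∘ sym ∘ toℕ-injective) =
  trans (+-identityʳ _) (⟦not⟧+⟦⟧ (toℕ j <ᵇ toℕ i))

module _ {n : ℕ} where

  ∑² : (Fin n → Fin n → ℕ) → ℕ
  ∑² g = ∑[ i ∈ allFin n ] ∑[ j ∈ allFin n ] g i j

  ∑²-cong : {g g' : Fin n → Fin n → ℕ} → (∀ i j → g i j ≡ g' i j) → ∑² g ≡ ∑² g'
  ∑²-cong g≗g' = ∑-cong (allFin n) (λ i → ∑-cong (allFin n) (g≗g' i))

  ∑²-distrib-+ : (g g' : Fin n → Fin n → ℕ) → ∑² (λ i j → g i j + g' i j) ≡ ∑² g + ∑² g'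
  ∑²-distrib-+ g g' = trans (∑-cong (allFin n) (λ i → ∑-distrib-+ (g i) (g' i) (allFin n)))
                            (∑-distrib-+ _ _ (allFin n))

  ∑²-*ʳ : (c : ℕ) (g : Fin n → Fin n → ℕ) → ∑² (λ i j → g i j * c) ≡ ∑² g * c
  ∑²-*ʳ c g = trans (∑-cong (allFin n) (λ i → ∑-*ʳ c (g i) (allFin n)))
                    (∑-*ʳ c (λ i → ∑[ j ∈ allFin n ] g i j) (allFin n))

  ⟦_<ᶠ_⟧ : Fin n → Fin n → ℕ
  ⟦ i <ᶠ j ⟧ = ⟦ toℕ i <ᵇ toℕ j ⟧

  ∑²-triangles : (h : Fin n → Fin n → ℕ) →
    ∑² (λ i j → ⟦ i <ᶠ j ⟧ * (h i j + h j i)) + ∑[ i ∈ allFin n ] h i i ≡ ∑² h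
  ∑²-triangles h = begin
    ∑² (λ i j → ⟦ i <ᶠ j ⟧ * (h i j + h j i)) + ∑[ i ∈ allFin n ] h i i
      ≡⟨ cong₂ _+_ (trans (∑²-cong (λ i j → *-distribˡ-+ ⟦ i <ᶠ j ⟧ (h i j) (h j i))) (∑²-distrib-+ _ _))
                   (∑-cong (allFin n) (λ i → sym (∑-δ (h i) i))) ⟩
    (∑² (λ i j → ⟦ i <ᶠ j ⟧ * h i j) + ∑² (λ i j → ⟦ i <ᶠ j ⟧ * h j i)) + ∑² (λ i j → ⟦ j =ᶠ i ⟧ * h i j)
      ≡⟨ cong (λ t → (∑² (λ i j → ⟦ i <ᶠ j ⟧ * h i j) + t) + ∑² (λ i j → ⟦ j =ᶠ i ⟧ * h i j))
              (∑-comm (λ i j → ⟦ i <ᶠ j ⟧ * h j i) (allFin n) (allFin n)) ⟩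
    (∑² (λ i j → ⟦ i <ᶠ j ⟧ * h i j) + ∑² (λ i j → ⟦ j <ᶠ i ⟧ * h i j)) + ∑² (λ i j → ⟦ j =ᶠ i ⟧ * h i j)
      ≡⟨ trans (cong (_+ ∑² (λ i j → ⟦ j =ᶠ i ⟧ * h i j)) (sym (∑²-distrib-+ _ _))) (sym (∑²-distrib-+ _ _)) ⟩
    ∑² (λ i j → ⟦ i <ᶠ j ⟧ * h i j + ⟦ j <ᶠ i ⟧ * h i j + ⟦ j =ᶠ i ⟧ * h i j)
      ≡⟨ ∑²-cong (λ i j → trans (factor ⟦ i <ᶠ j ⟧ ⟦ j <ᶠ i ⟧ ⟦ j =ᶠ i ⟧ (h i j))
                                (trans (cong (_* h i j) (trichotomy-indicator i j)) (+-identityʳ (h i j)))) ⟩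
    ∑² h ∎
    where
    open ≡-Reasoning
    factor : ∀ p q r x → p * x + q * x + r * x ≡ (p + q + r) * x
    factor = solve-∀

-- Permutations

module _ {n : ℕ} where

  Perm-ext : {σ τ : Perm n} → (∀ i → lookup σ i ≡ lookup τ i) → σ ≡ τ
  Perm-ext {σ} {τ} σ≗τ = trans (sym (tabulate∘lookup σ)) (trans (tabulate-cong σ≗τ) (tabulate∘lookup τ))

  lookup-· : (σ τ : Perm n) (i : Fin n) → lookup (σ · τ) i ≡ lookup σ (lookup τ i)
  lookup-· σ τ i = lookup∘tabulate _ i

  ·-assoc : (σ τ ρ : Perm n) → (σ · τ) · ρ ≡ σ · (τ · ρ)
  ·-assoc σ τ ρ = Perm-ext λ i → begin
    lookup ((σ · τ) · ρ) i           ≡⟨ lookup-· (σ · τ) ρ i ⟩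
    lookup (σ · τ) (lookup ρ i)      ≡⟨ lookup-· σ τ (lookup ρ i) ⟩
    lookup σ (lookup τ (lookup ρ i)) ≡⟨ cong (lookup σ) (lookup-· τ ρ i) ⟨
    lookup σ (lookup (τ · ρ) i)      ≡⟨ lookup-· σ (τ · ρ) i ⟨
    lookup (σ · (τ · ρ)) i           ∎
    where open ≡-Reasoning

  ·-identityˡ : (σ : Perm n) → idPerm · σ ≡ σ
  ·-identityˡ σ = Perm-ext λ i → trans (lookup-· idPerm σ i) (lookup∘tabulate id (lookup σ i))

  all-allFin⁺ : (p : Fin n → Bool) → T (all p (allFin n)) → ∀ i → T (p i)
  all-allFin⁺ p h i = All.lookup (all⁺ p (allFin n) h) (∈-allFin i)

  all-allFin⁻ : (p : Fin n → Bool) → (∀ i → T (p i)) → T (all p (allFin n))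
  all-allFin⁻ p h = all⁻ p {xs = allFin n} (All.tabulate (λ {i} _ → h i))

  isInjective-ordered : (σ : Perm n) → T (isInjective σ) →
    ∀ i j → toℕ i < toℕ j → lookup σ i ≢ lookup σ j
  isInjective-ordered σ inj i j i<j σi≡σj
    with toℕ i <ᵇ toℕ j | <⇒<ᵇ i<j | lookup σ i ≟ lookup σ j
       | all-allFin⁺ _ (all-allFin⁺ _ inj i) j
  ... | true | _ | no σi≢σj | _ = σi≢σj σi≡σj

  isInjective⇒Injective : (σ : Perm n) → T (isInjective σ) → Injective _≡_ _≡_ (lookup σ)
  isInjective⇒Injective σ inj {i} {j} σi≡σj with <-cmp (toℕ i) (toℕ j)
  ... | tri< i<j _ _ = ⊥-elim (isInjective-ordered σ inj i j i<j σi≡σj)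
  ... | tri≈ _ i≡j _ = toℕ-injective i≡j
  ... | tri> _ _ j<i = ⊥-elim (isInjective-ordered σ inj j i j<i (sym σi≡σj))

  Injective⇒isInjective : (σ : Perm n) → Injective _≡_ _≡_ (lookup σ) → T (isInjective σ)
  Injective⇒isInjective σ inj with T? (isInjective σ)
  ... | yes h = h
  ... | no ¬h with ¬∀⟶∃¬ n _ (λ i → T? _) (¬h ∘ all-allFin⁻ _)
  ...   | i , ¬row with ¬∀⟶∃¬ n _ (λ j → T? _) (¬row ∘ all-allFin⁻ _)
  ...     | j , ¬entry with toℕ i <ᵇ toℕ j in i<ᵇj | lookup σ i ≟ lookup σ j
  ...       | false | _         = ⊥-elim (¬entry _)
  ...       | true  | no _      = ⊥-elim (¬entry _)
  ...       | true  | yes σi≡σj = ⊥-elim (<-irrefl (cong toℕ (inj σi≡σj)) (<ᵇ⇒< (toℕ i) (toℕ j) (true⇒T i<ᵇj)))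


Injective⇒Surjective : ∀ {n} {f : Fin n → Fin n} → Injective _≡_ _≡_ f → ∀ y → ∃ λ x → f x ≡ y
Injective⇒Surjective {suc n} {f} inj y with any? (λ x → f x ≟ y)
... | yes hit = hit
... | no miss = ⊥-elim (noCollision (pigeonhole (n<1+n n) (λ x → punchOut (missed x))))
  where
  missed : ∀ x → y ≢ f x
  missed x y≡fx = miss (x , sym y≡fx)
  noCollision : ¬ ∃₂ λ x x' → toℕ x < toℕ x' × punchOut (missed x) ≡ punchOut (missed x')
  noCollision (x , x' , x<x' , eq) =
    <-irrefl (cong toℕ (inj (punchOut-injective (missed x) (missed x') eq))) x<x'

-- Counting injective words

module _ {n : ℕ} where

  occurs : ∀ {k} → Fin n → Vec (Fin n) k → Bool
  occurs a []      = false
  occurs a (b ∷ v) = (a =ᶠ b) ∨ occurs a v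

  distinct : ∀ {k} → Vec (Fin n) k → Bool
  distinct []      = true
  distinct (a ∷ v) = not (occurs a v) ∧ distinct v

  lookup⇒occurs : ∀ {k} (v : Vec (Fin n) k) i → T (occurs (lookup v i) v)
  lookup⇒occurs (b ∷ v) zero    rewrite dec-true (b ≟ b) refl = _
  lookup⇒occurs (b ∷ v) (suc i) with lookup v i =ᶠ b
  ... | true  = _
  ... | false = lookup⇒occurs v i

  occurs⇒lookup : ∀ {k} (a : Fin n) (v : Vec (Fin n) k) → T (occurs a v) → ∃ λ i → lookup v i ≡ a
  occurs⇒lookup a (b ∷ v) h with a ≟ b
  ... | yes a≡b = zero , sym a≡b
  ... | no  _   = let i , vi≡a = occurs⇒lookup a v h in suc i , vi≡a

  distinct-∷⁻ : ∀ {k} (a : Fin n) (v : Vec (Fin n) k) → T (distinct (a ∷ v)) → ¬ T (occurs a v) × T (distinct v)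
  distinct-∷⁻ a v h with occurs a v | distinct v
  ... | false | true = (λ ()) , _

  distinct⇒Injective : ∀ {k} (v : Vec (Fin n) k) → T (distinct v) → Injective _≡_ _≡_ (lookup v)
  distinct⇒Injective (a ∷ v) h {i} {j} = cons i j
    where
    a∉v : ¬ T (occurs a v)
    a∉v = proj₁ (distinct-∷⁻ a v h)
    cons : ∀ i j → lookup (a ∷ v) i ≡ lookup (a ∷ v) j → i ≡ j
    cons zero    zero    _     = refl
    cons zero    (suc j) a≡vj  = ⊥-elim (a∉v (subst (λ x → T (occurs x v)) (sym a≡vj) (lookup⇒occurs v j)))
    cons (suc i) zero    vi≡a  = ⊥-elim (a∉v (subst (λ x → T (occurs x v)) vi≡a (lookup⇒occurs v i)))
    cons (suc i) (suc j) vi≡vj = cong suc (distinct⇒Injective v (proj₂ (distinct-∷⁻ a v h)) vi≡vj)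

  Injective⇒distinct : ∀ {k} (v : Vec (Fin n) k) → Injective _≡_ _≡_ (lookup v) → T (distinct v)
  Injective⇒distinct []      inj = _
  Injective⇒distinct (a ∷ v) inj with occurs a v in occ
  ... | false = Injective⇒distinct v (suc-injective ∘ inj)
  ... | true with occurs⇒lookup a v (true⇒T occ)
  ...   | i , vi≡a = case inj {zero} {suc i} (sym vi≡a) of λ ()

  isInjective≡distinct : (σ : Perm n) → isInjective σ ≡ distinct σ
  isInjective≡distinct σ = T-ext (Injective⇒distinct σ ∘ isInjective⇒Injective σ)
                                 (Injective⇒isInjective σ ∘ distinct⇒Injective σ)

∑-words-suc : ∀ n k (f : Vec (Fin n) (suc k) → ℕ) →
  ∑ f (words n (suc k)) ≡ ∑[ a ∈ allFin n ] ∑[ v ∈ words n k ] f (a ∷ v)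
∑-words-suc n k f = trans (∑-concatMap f _ (allFin n)) (∑-cong (allFin n) (λ a → ∑-map f (a ∷_) (words n k)))

∑-words-≡ : ∀ n k (w : Vec (Fin n) k) → ∑[ v ∈ words n k ] ⟦ does (≡-dec _≟_ v w) ⟧ ≡ 1
∑-words-≡ n zero    []      = refl
∑-words-≡ n (suc k) (x ∷ w) = begin
  ∑[ v ∈ words n (suc k) ] ⟦ does (≡-dec _≟_ v (x ∷ w)) ⟧
    ≡⟨ ∑-words-suc n k _ ⟩
  ∑[ b ∈ allFin n ] ∑[ v ∈ words n k ] ⟦ (b =ᶠ x) ∧ does (≡-dec _≟_ v w) ⟧
    ≡⟨ ∑-cong (allFin n) (λ b → trans (∑-cong (words n k) (λ v → ⟦∧⟧ (b =ᶠ x) _))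
                                      (∑-*ˡ ⟦ b =ᶠ x ⟧ _ (words n k))) ⟩
  ∑[ b ∈ allFin n ] (⟦ b =ᶠ x ⟧ * ∑[ v ∈ words n k ] ⟦ does (≡-dec _≟_ v w) ⟧)
    ≡⟨ ∑-cong (allFin n) (λ b → trans (cong (⟦ b =ᶠ x ⟧ *_) (∑-words-≡ n k w)) (*-identityʳ _)) ⟩
  ∑[ b ∈ allFin n ] ⟦ b =ᶠ x ⟧
    ≡⟨ ∑-allFin-≟ x ⟩
  1 ∎
  where open ≡-Reasoning

module _ {n : ℕ} where

  ∑-occurs : ∀ {k} (v : Vec (Fin n) k) → T (distinct v) → ∑[ a ∈ allFin n ] ⟦ occurs a v ⟧ ≡ k
  ∑-occurs []      _ = ∑-zero (allFin n)
  ∑-occurs (b ∷ v) h = begin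
    ∑[ a ∈ allFin n ] ⟦ (a =ᶠ b) ∨ occurs a v ⟧                ≡⟨ ∑-cong (allFin n) split ⟩
    ∑[ a ∈ allFin n ] (⟦ a =ᶠ b ⟧ + ⟦ occurs a v ⟧)           ≡⟨ ∑-distrib-+ _ _ (allFin n) ⟩
    ∑[ a ∈ allFin n ] ⟦ a =ᶠ b ⟧ + ∑[ a ∈ allFin n ] ⟦ occurs a v ⟧
      ≡⟨ cong₂ _+_ (∑-allFin-≟ b) (∑-occurs v (proj₂ (distinct-∷⁻ b v h))) ⟩
    suc _ ∎
    where
    open ≡-Reasoning
    split : ∀ a → ⟦ (a =ᶠ b) ∨ occurs a v ⟧ ≡ ⟦ a =ᶠ b ⟧ + ⟦ occurs a v ⟧
    split a with a ≟ b
    ... | no _     = refl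
    ... | yes refl with occurs a v | proj₁ (distinct-∷⁻ b v h)
    ...   | false | _ = refl
    ...   | true  | b∉v = ⊥-elim (b∉v _)

  ∑-not-occurs : ∀ {k} (v : Vec (Fin n) k) → T (distinct v) → ∑[ a ∈ allFin n ] ⟦ not (occurs a v) ⟧ ≡ n ∸ k
  ∑-not-occurs {k} v h = begin
    fresh                                        ≡⟨ m+n∸n≡m fresh k ⟨
    fresh + k ∸ k                                ≡⟨ cong (λ o → fresh + o ∸ k) (∑-occurs v h) ⟨
    fresh + ∑[ a ∈ allFin n ] ⟦ occurs a v ⟧ ∸ k ≡⟨ cong (_∸ k) (∑-complement (λ a → occurs a v) (allFin n)) ⟩
    length (allFin n) ∸ k                        ≡⟨ cong (_∸ k) (length-allFin n) ⟩
    n ∸ k                                        ∎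
    where
    open ≡-Reasoning
    fresh : ℕ
    fresh = ∑[ a ∈ allFin n ] ⟦ not (occurs a v) ⟧

  count-distinct : ∀ k → ∑[ v ∈ words n k ] ⟦ distinct v ⟧ ≡ n P′ k
  count-distinct zero    = refl
  count-distinct (suc k) = begin
    ∑[ v ∈ words n (suc k) ] ⟦ distinct v ⟧
      ≡⟨ ∑-words-suc n k _ ⟩
    ∑[ a ∈ allFin n ] ∑[ v ∈ words n k ] ⟦ not (occurs a v) ∧ distinct v ⟧
      ≡⟨ ∑-comm _ (allFin n) (words n k) ⟩
    ∑[ v ∈ words n k ] ∑[ a ∈ allFin n ] ⟦ not (occurs a v) ∧ distinct v ⟧
      ≡⟨ ∑-cong (words n k) extensions ⟩
    ∑[ v ∈ words n k ] ((n ∸ k) * ⟦ distinct v ⟧)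
      ≡⟨ ∑-*ˡ (n ∸ k) _ (words n k) ⟩
    (n ∸ k) * ∑[ v ∈ words n k ] ⟦ distinct v ⟧
      ≡⟨ cong ((n ∸ k) *_) (count-distinct k) ⟩
    (n ∸ k) * (n P′ k) ∎
    where
    open ≡-Reasoning
    extensions : ∀ v → ∑[ a ∈ allFin n ] ⟦ not (occurs a v) ∧ distinct v ⟧ ≡ (n ∸ k) * ⟦ distinct v ⟧
    extensions v with distinct v in dv
    ... | true  = trans (∑-cong (allFin n) (λ a → cong ⟦_⟧ (∧-identityʳ _)))
                        (trans (∑-not-occurs v (true⇒T dv)) (sym (*-identityʳ _)))
    ... | false = trans (∑-cong (allFin n) (λ a → cong ⟦_⟧ (∧-zeroʳ _)))
                        (trans (∑-zero (allFin n)) (sym (*-zeroʳ (n ∸ k))))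

nP′n≡n! : ∀ n → n P′ n ≡ n !
nP′n≡n! n = trans (cong (if_then n P′ n else 0) (sym (T⇒true (≤⇒≤ᵇ (≤-refl {n}))))) (nPn≡n! n)

-- Parity of the inversion count, and the order of Aₙ

even : ℕ → Bool
even zero          = true
even (suc zero)    = false
even (suc (suc n)) = even n

even-suc : ∀ n → even (suc n) ≡ not (even n)
even-suc zero          = refl
even-suc (suc zero)    = refl
even-suc (suc (suc n)) = even-suc n

even-+ : ∀ a b → T (even a) → T (even b) → T (even (a + b))
even-+ zero          b _  eb = eb
even-+ (suc (suc a)) b ea eb = even-+ a b ea eb

even-+⇒≡ : ∀ a b → T (even (a + b)) → even a ≡ even b
even-+⇒≡ zero          b eab = T-ext (λ _ → eab) (λ _ → tt)
even-+⇒≡ (suc zero)    b eab with even b | subst T (even-suc b) eab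
... | false | _ = refl
even-+⇒≡ (suc (suc a)) b eab = even-+⇒≡ a b eab

∑-even : {A : Set} (f : A → ℕ) (xs : List A) → (∀ x → T (even (f x))) → T (even (∑ f xs))
∑-even f []       _  = _
∑-even f (x ∷ xs) ev = even-+ (f x) (∑ f xs) (ev x) (∑-even f xs ev)

inverted : ∀ {n} → (Fin n → ℕ) → Fin n → Fin n → ℕ
inverted x i j = ⟦ (toℕ i <ᵇ toℕ j) ∧ (x j <ᵇ x i) ⟧

-- Summing over tabulate rather than allFin lets the sums unfold definitionally
-- on the first positions (see inversionCount-swap₀₁).
inversionCount : ∀ {n} → (Fin n → ℕ) → ℕ
inversionCount x = sum (List.tabulate λ i → sum (List.tabulate λ j → inverted x i j))

inversionCount≡∑ : ∀ {n} (x : Fin n → ℕ) → inversionCount x ≡ ∑[ i ∈ allFin n ] ∑[ j ∈ allFin n ] inverted x i j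
inversionCount≡∑ {n} x = trans (cong sum (Listₚ.tabulate-cong (λ i → sym (∑-allFin≡sum-tabulate (inverted x i)))))
  (sym (∑-allFin≡sum-tabulate (λ i → ∑[ j ∈ allFin n ] inverted x i j)))

values : ∀ {n k} → Vec (Fin n) k → Fin k → ℕ
values v = toℕ ∘ lookup v

inversions≡inversionCount : ∀ {n} (σ : Perm n) → inversions σ ≡ inversionCount (values σ)
inversions≡inversionCount {n} σ =
  trans (∑-cong (allFin n) (λ i → length-filterᵇ _ (allFin n))) (sym (inversionCount≡∑ (values σ)))

isEven≡even : ∀ {n} (σ : Perm n) → isEven σ ≡ even (inversionCount (values σ))
isEven≡even σ = trans (isEven-%2 σ) (trans (%2≡ᵇ0 (inversions σ)) (cong even (inversions≡inversionCount σ)))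
  where
  isEven-%2 : ∀ {n} (σ : Perm n) → isEven σ ≡ (inversions σ % 2 ≡ᵇ 0)
  isEven-%2 σ with inversions σ % 2
  ... | zero  = refl
  ... | suc _ = refl
  %2≡ᵇ0 : ∀ k → (k % 2 ≡ᵇ 0) ≡ even k
  %2≡ᵇ0 zero          = refl
  %2≡ᵇ0 (suc zero)    = refl
  %2≡ᵇ0 (suc (suc k)) = %2≡ᵇ0 k

inversionCount-cong : ∀ {n} {x y : Fin n → ℕ} → (∀ i → x i ≡ y i) → inversionCount x ≡ inversionCount y
inversionCount-cong x≗y = cong sum (Listₚ.tabulate-cong λ i → cong sum (Listₚ.tabulate-cong λ j →
  cong₂ (λ u v → ⟦ (toℕ i <ᵇ toℕ j) ∧ (u <ᵇ v) ⟧) (x≗y j) (x≗y i)))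

swap₀₁ : ∀ {A : Set} {k} → Vec A (suc (suc k)) → Vec A (suc (suc k))
swap₀₁ (a ∷ b ∷ v) = b ∷ a ∷ v

-- Only the pair of positions 0, 1 changes its inversion status; every other
-- term of the two double sums agrees definitionally.
inversionCount-swap₀₁ : ∀ {n k} (a b : Fin n) (v : Vec (Fin n) k) →
  inversionCount (values (a ∷ b ∷ v)) + ⟦ toℕ a <ᵇ toℕ b ⟧
    ≡ inversionCount (values (b ∷ a ∷ v)) + ⟦ toℕ b <ᵇ toℕ a ⟧
inversionCount-swap₀₁ a b v = rearrange ⟦ toℕ b <ᵇ toℕ a ⟧ ⟦ toℕ a <ᵇ toℕ b ⟧ _ _ _
  where
  rearrange : ∀ p q x y r → (p + x + (y + r)) + q ≡ (q + y + (x + r)) + p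
  rearrange = solve-∀

even-flip : ∀ x y p q → x + ⟦ p ⟧ ≡ y + ⟦ q ⟧ → p ≡ not q → even y ≡ not (even x)
even-flip x y true  false x+1≡y refl =
  trans (cong even (trans (sym (+-identityʳ y)) (trans (sym x+1≡y) (+-comm x 1)))) (even-suc x)
even-flip x y false true  x≡y+1 refl = trans (sym (not-involutive (even y)))
  (cong not (sym (trans (cong even (trans (sym (+-identityʳ x)) (trans x≡y+1 (+-comm y 1)))) (even-suc y))))

even-swap₀₁ : ∀ {n k} (w : Vec (Fin n) (suc (suc k))) → lookup w zero ≢ lookup w (suc zero) →
  even (inversionCount (values (swap₀₁ w))) ≡ not (even (inversionCount (values w)))
even-swap₀₁ (a ∷ b ∷ v) a≢b =
  even-flip _ _ _ _ (inversionCount-swap₀₁ a b v) (<ᵇ≡not>ᵇ (a≢b ∘ toℕ-injective))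

distinct-swap₀₁ : ∀ {n k} (w : Vec (Fin n) (suc (suc k))) → distinct (swap₀₁ w) ≡ distinct w
distinct-swap₀₁ (a ∷ b ∷ v) rewrite =ᶠ-sym b a = exchange (a =ᶠ b) (occurs a v) (occurs b v) (distinct v)
  where
  exchange : ∀ e x y z → not (e ∨ y) ∧ (not x ∧ z) ≡ not (e ∨ x) ∧ (not y ∧ z)
  exchange true  x     y     z = refl
  exchange false true  true  z = refl
  exchange false true  false z = refl
  exchange false false true  z = refl
  exchange false false false z = refl

∑-words-swap₀₁ : ∀ n k (f : Vec (Fin n) (suc (suc k)) → ℕ) →
  ∑ f (words n (suc (suc k))) ≡ ∑ (f ∘ swap₀₁) (words n (suc (suc k)))
∑-words-swap₀₁ n k f = begin
  ∑ f (words n (suc (suc k)))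
    ≡⟨ expand f ⟩
  ∑[ a ∈ allFin n ] ∑[ b ∈ allFin n ] ∑[ v ∈ words n k ] f (a ∷ b ∷ v)
    ≡⟨ ∑-comm (λ a b → ∑[ v ∈ words n k ] f (a ∷ b ∷ v)) (allFin n) (allFin n) ⟩
  ∑[ b ∈ allFin n ] ∑[ a ∈ allFin n ] ∑[ v ∈ words n k ] f (a ∷ b ∷ v)
    ≡⟨ expand (f ∘ swap₀₁) ⟨
  ∑ (f ∘ swap₀₁) (words n (suc (suc k))) ∎
  where
  open ≡-Reasoning
  expand : (g : Vec (Fin n) (suc (suc k)) → ℕ) →
    ∑ g (words n (suc (suc k))) ≡ ∑[ a ∈ allFin n ] ∑[ b ∈ allFin n ] ∑[ v ∈ words n k ] g (a ∷ b ∷ v)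
  expand g = trans (∑-words-suc n (suc k) g) (∑-cong (allFin n) (λ a → ∑-words-suc n k (λ w → g (a ∷ w))))

2*|Alt|≡n! : ∀ m → let n = suc (suc m) in 2 * length (Alt n) ≡ n !
2*|Alt|≡n! m = begin
  2 * length (Alt n)                    ≡⟨ cong (2 *_) (length-filterᵇ _ W) ⟩
  ∑ evenPerm W + (∑ evenPerm W + 0)     ≡⟨ cong (∑ evenPerm W +_) (trans (+-identityʳ _) evens≡odds) ⟩
  ∑ evenPerm W + ∑ oddPerm W            ≡⟨ ∑-distrib-+ evenPerm oddPerm W ⟨
  ∑[ w ∈ W ] (evenPerm w + oddPerm w)   ≡⟨ ∑-cong W (λ w → split (isInjective w) (isEven w)) ⟩
  ∑[ w ∈ W ] ⟦ isInjective w ⟧          ≡⟨ ∑-cong W (λ w → cong ⟦_⟧ (isInjective≡distinct w)) ⟩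
  ∑[ w ∈ W ] ⟦ distinct w ⟧             ≡⟨ count-distinct {n} n ⟩
  n P′ n                                ≡⟨ nP′n≡n! n ⟩
  n !                                   ∎
  where
  open ≡-Reasoning
  n : ℕ
  n = suc (suc m)
  W : List (Perm n)
  W = words n n
  evenPerm oddPerm : Perm n → ℕ
  evenPerm w = ⟦ isInjective w ∧ isEven w ⟧
  oddPerm  w = ⟦ isInjective w ∧ not (isEven w) ⟧

  split : ∀ i e → ⟦ i ∧ e ⟧ + ⟦ i ∧ not e ⟧ ≡ ⟦ i ⟧
  split true  true  = refl
  split true  false = refl
  split false e     = refl

  swap₀₁-even≡odd : ∀ w → evenPerm (swap₀₁ w) ≡ oddPerm w
  swap₀₁-even≡odd w with isInjective≡distinct (swap₀₁ w) | isInjective≡distinct w | distinct-swap₀₁ w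
  ... | eq₁ | eq₂ | eq₃ rewrite eq₁ | eq₂ | eq₃ with distinct w in dw
  ... | false = refl
  ... | true  = cong ⟦_⟧ (trans (isEven≡even (swap₀₁ w))
                         (trans (even-swap₀₁ w w₀≢w₁) (cong not (sym (isEven≡even w)))))
    where
    w₀≢w₁ : lookup w zero ≢ lookup w (suc zero)
    w₀≢w₁ eq = case distinct⇒Injective w (true⇒T dw) eq of λ ()

  evens≡odds : ∑ evenPerm W ≡ ∑ oddPerm W
  evens≡odds = trans (∑-words-swap₀₁ n m evenPerm) (∑-cong W swap₀₁-even≡odd)

-- Three-cycles of consecutive letters are even

rotate₃ : ℕ → ℕ → ℕ
rotate₃ A x =
  if x ≡ᵇ A then suc A else if x ≡ᵇ suc A then suc (suc A) else if x ≡ᵇ suc (suc A) then A else x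

rotate₃-suc : ∀ A x → rotate₃ (suc A) (suc x) ≡ suc (rotate₃ A x)
rotate₃-suc A x with x ≡ᵇ A
... | true  = refl
... | false with x ≡ᵇ suc A
...   | true  = refl
...   | false with x ≡ᵇ suc (suc A)
...     | true  = refl
...     | false = refl

rotate₃-cube : ∀ A x → rotate₃ A (rotate₃ A (rotate₃ A x)) ≡ x
rotate₃-cube zero    zero                = refl
rotate₃-cube zero    (suc zero)          = refl
rotate₃-cube zero    (suc (suc zero))    = refl
rotate₃-cube zero    (suc (suc (suc x))) = refl
rotate₃-cube (suc A) zero                = refl
rotate₃-cube (suc A) (suc x)
  rewrite rotate₃-suc A x | rotate₃-suc A (rotate₃ A x) | rotate₃-suc A (rotate₃ A (rotate₃ A x)) =
  cong suc (rotate₃-cube A x)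

rotate₃-first : ∀ A → rotate₃ A A ≡ suc A
rotate₃-first zero    = refl
rotate₃-first (suc A) = trans (rotate₃-suc A A) (cong suc (rotate₃-first A))

rotate₃-second : ∀ A → rotate₃ A (suc A) ≡ suc (suc A)
rotate₃-second zero    = refl
rotate₃-second (suc A) = trans (rotate₃-suc A (suc A)) (cong suc (rotate₃-second A))

crossing : ℕ → ℕ → ℕ → ℕ → ℕ
crossing P Q u v = ⟦ u ≡ᵇ P ⟧ * ⟦ v ≡ᵇ Q ⟧ + ⟦ u ≡ᵇ Q ⟧ * ⟦ v ≡ᵇ P ⟧

reversedBy-rotate₃ : ℕ → ℕ → ℕ → ℕ
reversedBy-rotate₃ A u v = crossing (suc A) (suc (suc A)) u v + crossing A (suc (suc A)) u v

inversionBalance : ℕ → ℕ → ℕ → ℕ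
inversionBalance A u v = ⟦ rotate₃ A v <ᵇ rotate₃ A u ⟧ + ⟦ v <ᵇ u ⟧ + reversedBy-rotate₃ A u v

inversionBalance-even : ∀ A u v → T (even (inversionBalance A u v))
inversionBalance-even zero zero                zero                = _
inversionBalance-even zero zero                (suc zero)          = _
inversionBalance-even zero zero                (suc (suc zero))    = _
inversionBalance-even zero zero                (suc (suc (suc v))) = _
inversionBalance-even zero (suc zero)          zero                = _
inversionBalance-even zero (suc zero)          (suc zero)          = _
inversionBalance-even zero (suc zero)          (suc (suc zero))    = _
inversionBalance-even zero (suc zero)          (suc (suc (suc v))) = _
inversionBalance-even zero (suc (suc zero))    zero                = _
inversionBalance-even zero (suc (suc zero))    (suc zero)          = _
inversionBalance-even zero (suc (suc zero))    (suc (suc zero))    = _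
inversionBalance-even zero (suc (suc zero))    (suc (suc (suc v))) = _
inversionBalance-even zero (suc (suc (suc u))) zero                = _
inversionBalance-even zero (suc (suc (suc u))) (suc zero)          = _
inversionBalance-even zero (suc (suc (suc u))) (suc (suc zero))    = _
inversionBalance-even zero (suc (suc (suc u))) (suc (suc (suc v))) = double (v <ᵇ u)
  where
  double : ∀ b → T (even (⟦ b ⟧ + ⟦ b ⟧ + 0))
  double true  = tt
  double false = tt
inversionBalance-even (suc A) zero    v = _
inversionBalance-even (suc A) (suc u) zero with u ≡ᵇ A | u ≡ᵇ suc A | u ≡ᵇ suc (suc A)
... | true  | true  | true  = _
... | true  | true  | false = _
... | true  | false | true  = _
... | true  | false | false = _
... | false | true  | true  = _
... | false | true  | false = _
... | false | false | true  = _
... | false | false | false = _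
inversionBalance-even (suc A) (suc u) (suc v) rewrite rotate₃-suc A u | rotate₃-suc A v =
  inversionBalance-even A u v

occurrences : ∀ {n} → (Fin n → ℕ) → ℕ → ℕ
occurrences {n} x P = ∑[ i ∈ allFin n ] ⟦ x i ≡ᵇ P ⟧

∑²-crossing : ∀ {n} (x : Fin n → ℕ) {P Q : ℕ} → P ≢ Q → occurrences x P ≡ 1 → occurrences x Q ≡ 1 →
  ∑² (λ i j → ⟦ i <ᶠ j ⟧ * crossing P Q (x i) (x j)) ≡ 1
∑²-crossing {n} x {P} {Q} P≢Q #P≡1 #Q≡1 = begin
  ∑² (λ i j → ⟦ i <ᶠ j ⟧ * crossing P Q (x i) (x j))
    ≡⟨ ∑²-cong (λ i j → cong (λ t → ⟦ i <ᶠ j ⟧ * (h i j + t)) (*-comm ⟦ x i ≡ᵇ Q ⟧ ⟦ x j ≡ᵇ P ⟧)) ⟩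
  ∑² (λ i j → ⟦ i <ᶠ j ⟧ * (h i j + h j i))
    ≡⟨ +-identityʳ _ ⟨
  ∑² (λ i j → ⟦ i <ᶠ j ⟧ * (h i j + h j i)) + 0
    ≡⟨ cong (∑² (λ i j → ⟦ i <ᶠ j ⟧ * (h i j + h j i)) +_)
            (trans (∑-cong (allFin n) P-and-Q) (∑-zero (allFin n))) ⟨
  ∑² (λ i j → ⟦ i <ᶠ j ⟧ * (h i j + h j i)) + ∑[ i ∈ allFin n ] h i i
    ≡⟨ ∑²-triangles h ⟩
  ∑² h
    ≡⟨ ∑-cong (allFin n) (λ i → ∑-*ˡ ⟦ x i ≡ᵇ P ⟧ (λ j → ⟦ x j ≡ᵇ Q ⟧) (allFin n)) ⟩
  ∑[ i ∈ allFin n ] (⟦ x i ≡ᵇ P ⟧ * occurrences x Q)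
    ≡⟨ ∑-*ʳ (occurrences x Q) (λ i → ⟦ x i ≡ᵇ P ⟧) (allFin n) ⟩
  occurrences x P * occurrences x Q
    ≡⟨ cong₂ _*_ #P≡1 #Q≡1 ⟩
  1 ∎
  where
  open ≡-Reasoning
  h : Fin n → Fin n → ℕ
  h i j = ⟦ x i ≡ᵇ P ⟧ * ⟦ x j ≡ᵇ Q ⟧
  P-and-Q : ∀ i → h i i ≡ 0
  P-and-Q i with x i ≡ᵇ P in xi≡P | x i ≡ᵇ Q in xi≡Q
  ... | false | _     = refl
  ... | true  | false = refl
  ... | true  | true  =
    ⊥-elim (P≢Q (trans (sym (≡ᵇ⇒≡ (x i) P (true⇒T xi≡P))) (≡ᵇ⇒≡ (x i) Q (true⇒T xi≡Q))))

∑-inversionBalance : ∀ {n} (x : Fin n → ℕ) (A : ℕ) →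
  occurrences x A ≡ 1 → occurrences x (suc A) ≡ 1 → occurrences x (suc (suc A)) ≡ 1 →
  inversionCount (rotate₃ A ∘ x) + inversionCount x + 2 ≡ ∑² (λ i j → ⟦ i <ᶠ j ⟧ * inversionBalance A (x i) (x j))
∑-inversionBalance {n} x A #A #A+1 #A+2 = begin
  inversionCount (rotate₃ A ∘ x) + inversionCount x + 2
    ≡⟨ cong₂ (λ a b → a + b + 2) (inversionCount≡∑ (rotate₃ A ∘ x)) (inversionCount≡∑ x) ⟩
  ∑² after + ∑² before + (1 + 1)
    ≡⟨ cong (∑² after + ∑² before +_)
            (sym (cong₂ _+_ (∑²-crossing x (1+n≢n ∘ sym) #A+1 #A+2) (∑²-crossing x (m≢1+n+m A) #A #A+2))) ⟩
  ∑² after + ∑² before + (∑² (reversal (suc A)) + ∑² (reversal A))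
    ≡⟨ cong₂ _+_ (∑²-distrib-+ after before) (∑²-distrib-+ (reversal (suc A)) (reversal A)) ⟨
  ∑² (λ i j → after i j + before i j) + ∑² (λ i j → reversal (suc A) i j + reversal A i j)
    ≡⟨ ∑²-distrib-+ (λ i j → after i j + before i j) (λ i j → reversal (suc A) i j + reversal A i j) ⟨
  ∑² (λ i j → after i j + before i j + (reversal (suc A) i j + reversal A i j))
    ≡⟨ ∑²-cong (λ i j → regroup (toℕ i <ᵇ toℕ j) (rotate₃ A (x j) <ᵇ rotate₃ A (x i)) (x j <ᵇ x i)
                                (crossing (suc A) (suc (suc A)) (x i) (x j)) (crossing A (suc (suc A)) (x i) (x j))) ⟩
  ∑² (λ i j → ⟦ i <ᶠ j ⟧ * inversionBalance A (x i) (x j)) ∎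
  where
  open ≡-Reasoning
  after before : Fin n → Fin n → ℕ
  after  = inverted (rotate₃ A ∘ x)
  before = inverted x
  reversal : ℕ → Fin n → Fin n → ℕ
  reversal P i j = ⟦ i <ᶠ j ⟧ * crossing P (suc (suc A)) (x i) (x j)
  regroup : ∀ p a b c d →
    ⟦ p ∧ a ⟧ + ⟦ p ∧ b ⟧ + (⟦ p ⟧ * c + ⟦ p ⟧ * d) ≡ ⟦ p ⟧ * (⟦ a ⟧ + ⟦ b ⟧ + (c + d))
  regroup true  a b c d = units ⟦ a ⟧ ⟦ b ⟧ c d
    where
    units : ∀ a b c d → a + b + ((c + 0) + (d + 0)) ≡ (a + b + (c + d)) + 0
    units = solve-∀
  regroup false a b c d = refl

rotate₃-preserves-parity : ∀ {n} (x : Fin n → ℕ) (A : ℕ) →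
  occurrences x A ≡ 1 → occurrences x (suc A) ≡ 1 → occurrences x (suc (suc A)) ≡ 1 →
  even (inversionCount (rotate₃ A ∘ x)) ≡ even (inversionCount x)
rotate₃-preserves-parity {n} x A #A #A+1 #A+2 = begin
  even (inversionCount (rotate₃ A ∘ x)) ≡⟨ even-+⇒≡ (inversionCount (rotate₃ A ∘ x)) _ sum-even ⟩
  even (inversionCount x + 2)           ≡⟨ cong even (+-comm (inversionCount x) 2) ⟩
  even (inversionCount x)               ∎
  where
  open ≡-Reasoning
  even-⟦⟧* : ∀ p {e} → T (even e) → T (even (⟦ p ⟧ * e))
  even-⟦⟧* true  {e} ev = subst (T ∘ even) (sym (+-identityʳ e)) ev
  even-⟦⟧* false     _  = _
  sum-even : T (even (inversionCount (rotate₃ A ∘ x) + (inversionCount x + 2)))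
  sum-even = subst (T ∘ even) (trans (sym (∑-inversionBalance x A #A #A+1 #A+2)) (+-assoc _ (inversionCount x) 2))
    (∑-even _ (allFin n) (λ i → ∑-even _ (allFin n) (λ j →
      even-⟦⟧* (toℕ i <ᵇ toℕ j) (inversionBalance-even A (x i) (x j)))))

occurrences-values : ∀ {n} (σ : Perm n) → Injective _≡_ _≡_ (lookup σ) → (u : Fin n) →
  occurrences (values σ) (toℕ u) ≡ 1
occurrences-values {n} σ inj u with Injective⇒Surjective inj u
... | i₀ , σi₀≡u = trans (∑-cong (allFin n) at-i₀) (∑-allFin-≟ i₀)
  where
  at-i₀ : ∀ i → ⟦ values σ i ≡ᵇ toℕ u ⟧ ≡ ⟦ i =ᶠ i₀ ⟧
  at-i₀ i = cong ⟦_⟧ (trans (sym (=ᶠ≡≡ᵇ (lookup σ i) u))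
    (T-ext (λ σi≡u → does-complete (i ≟ i₀) (inj (trans (does-sound (lookup σ i ≟ u) σi≡u) (sym σi₀≡u))))
           (λ i≡i₀ → does-complete (lookup σ i ≟ u) (trans (cong (lookup σ) (does-sound (i ≟ i₀) i≡i₀)) σi₀≡u))))

module ThreeCycle (m : ℕ) (s : Fin (suc m)) where

  γ : Perm (3 + m)
  γ = threeCycle m s

  A : ℕ
  A = toℕ s

  p₀ p₁ p₂ : Fin (3 + m)
  p₀ = inject₁ (inject₁ s)
  p₁ = suc (inject₁ s)
  p₂ = suc (suc s)

  toℕ-p₀ : toℕ p₀ ≡ A
  toℕ-p₀ = trans (toℕ-inject₁ (inject₁ s)) (toℕ-inject₁ s)

  toℕ-p₁ : toℕ p₁ ≡ suc A
  toℕ-p₁ = cong suc (toℕ-inject₁ s)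

  γ-map : Fin (3 + m) → Fin (3 + m)
  γ-map j = if j =ᶠ p₀ then p₁ else if j =ᶠ p₁ then p₂ else if j =ᶠ p₂ then p₀ else j

  toℕ-lookup-γ : ∀ j → toℕ (lookup γ j) ≡ rotate₃ A (toℕ j)
  toℕ-lookup-γ j
    rewrite lookup∘tabulate γ-map j | =ᶠ≡≡ᵇ j p₀ | =ᶠ≡≡ᵇ j p₁ | =ᶠ≡≡ᵇ j p₂ | toℕ-p₀ | toℕ-p₁
    with toℕ j ≡ᵇ A
  ... | true  = toℕ-p₁
  ... | false with toℕ j ≡ᵇ suc A
  ...   | true  = refl
  ...   | false with toℕ j ≡ᵇ suc (suc A)
  ...     | true  = toℕ-p₀
  ...     | false = refl

  values-γ· : ∀ (x : Perm (3 + m)) i → values (γ · x) i ≡ rotate₃ A (values x i)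
  values-γ· x i = trans (cong toℕ (lookup-· γ x i)) (toℕ-lookup-γ (lookup x i))

  γ·γ·γ· : ∀ x → γ · (γ · (γ · x)) ≡ x
  γ·γ·γ· x = Perm-ext λ i → toℕ-injective (begin
    values (γ · (γ · (γ · x))) i                    ≡⟨ values-γ· (γ · (γ · x)) i ⟩
    rotate₃ A (values (γ · (γ · x)) i)              ≡⟨ cong (rotate₃ A) (values-γ· (γ · x) i) ⟩
    rotate₃ A (rotate₃ A (values (γ · x) i))        ≡⟨ cong (rotate₃ A ∘ rotate₃ A) (values-γ· x i) ⟩
    rotate₃ A (rotate₃ A (rotate₃ A (values x i)))  ≡⟨ rotate₃-cube A (values x i) ⟩
    values x i                                      ∎)
    where open ≡-Reasoning

  γ·-injective : ∀ x → Injective _≡_ _≡_ (lookup x) → Injective _≡_ _≡_ (lookup (γ · x))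
  γ·-injective x inj {i} {j} eq = inj (toℕ-injective (begin
    values x i                                      ≡⟨ rotate₃-cube A (values x i) ⟨
    rotate₃ A (rotate₃ A (rotate₃ A (values x i)))  ≡⟨ cong (rotate₃ A ∘ rotate₃ A) rotated ⟩
    rotate₃ A (rotate₃ A (rotate₃ A (values x j)))  ≡⟨ rotate₃-cube A (values x j) ⟩
    values x j                                      ∎))
    where
    open ≡-Reasoning
    rotated : rotate₃ A (values x i) ≡ rotate₃ A (values x j)
    rotated = trans (sym (values-γ· x i)) (trans (cong toℕ eq) (values-γ· x j))

  isEven-γ· : ∀ x → Injective _≡_ _≡_ (lookup x) → isEven (γ · x) ≡ isEven x
  isEven-γ· x inj = begin
    isEven (γ · x)                                    ≡⟨ isEven≡even (γ · x) ⟩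
    even (inversionCount (values (γ · x)))            ≡⟨ cong even (inversionCount-cong (values-γ· x)) ⟩
    even (inversionCount (rotate₃ A ∘ values x))
      ≡⟨ rotate₃-preserves-parity (values x) A (once p₀ toℕ-p₀) (once p₁ toℕ-p₁) (once p₂ refl) ⟩
    even (inversionCount (values x))                  ≡⟨ isEven≡even x ⟨
    isEven x                                          ∎
    where
    open ≡-Reasoning
    once : ∀ p {P} → toℕ p ≡ P → occurrences (values x) P ≡ 1
    once p refl = occurrences-values x inj p

  γ-orbit-distinct : ∀ x → Injective _≡_ _≡_ (lookup x) →
    x ≢ γ · x × x ≢ γ · (γ · x) × γ · x ≢ γ · (γ · x)
  γ-orbit-distinct x inj with Injective⇒Surjective inj p₀
  ... | i , xi≡p₀ =
      (λ eq → 1+n≢n (trans (sym v₁) (trans (cong (λ y → values y i) (sym eq)) v₀)))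
    , (λ eq → m≢1+n+m A (trans (sym v₀) (trans (cong (λ y → values y i) eq) v₂)))
    , (λ eq → 1+n≢n (trans (sym v₂) (trans (cong (λ y → values y i) (sym eq)) v₁)))
    where
    v₀ : values x i ≡ A
    v₀ = trans (cong toℕ xi≡p₀) toℕ-p₀
    v₁ : values (γ · x) i ≡ suc A
    v₁ = trans (values-γ· x i) (trans (cong (rotate₃ A) v₀) (rotate₃-first A))
    v₂ : values (γ · (γ · x)) i ≡ suc (suc A)
    v₂ = trans (values-γ· (γ · x) i) (trans (cong (rotate₃ A) v₁) (rotate₃-second A))

-- Cosets of a three-cycle in Aₙ

isAlt : ∀ {n} → Perm n → Bool
isAlt σ = isInjective σ ∧ isEven σ

_∈ᵇ_ : ∀ {n} → Perm n → List (Perm n) → Bool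
g ∈ᵇ C = any (g =ᵖ_) C

module _ {n : ℕ} where

  ∈ᵇ⇒∈ : (g : Perm n) (C : List (Perm n)) → T (g ∈ᵇ C) → g ∈ C
  ∈ᵇ⇒∈ g C h = Any.map (λ {h} → does-sound (≡-dec _≟_ g h)) (any⁻ (g =ᵖ_) C h)

  ∈⇒∈ᵇ : (g : Perm n) (C : List (Perm n)) → g ∈ C → T (g ∈ᵇ C)
  ∈⇒∈ᵇ g C g∈C = any⁺ (g =ᵖ_) (Any.map (λ {h} → does-complete (≡-dec _≟_ g h)) g∈C)

  ⟦∈ᵇ⟧≡∑ : (g : Perm n) {C : List (Perm n)} → Unique C → ⟦ g ∈ᵇ C ⟧ ≡ ∑[ c ∈ C ] ⟦ g =ᵖ c ⟧
  ⟦∈ᵇ⟧≡∑ g {[]}    []             = refl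
  ⟦∈ᵇ⟧≡∑ g {c ∷ C} (c∉C ∷ unique) with ≡-dec _≟_ g c
  ... | no  _    = ⟦∈ᵇ⟧≡∑ g unique
  ... | yes refl = cong suc (trans (sym (cong ⟦_⟧ g∉C)) (⟦∈ᵇ⟧≡∑ g unique))
    where
    g∉C : (g ∈ᵇ C) ≡ false
    g∉C with g ∈ᵇ C in g∈C
    ... | false = refl
    ... | true  = ⊥-elim (All.lookup c∉C (∈ᵇ⇒∈ g C (true⇒T g∈C)) refl)

  ∑-Alt-∈ᵇ : (C : List (Perm n)) → Unique C → (∀ {c} → c ∈ C → T (isAlt c)) →
    ∑[ g ∈ Alt n ] ⟦ g ∈ᵇ C ⟧ ≡ length C
  ∑-Alt-∈ᵇ C unique C⊆Alt = begin
    ∑[ g ∈ Alt n ] ⟦ g ∈ᵇ C ⟧                   ≡⟨ ∑-filter (T? ∘ isAlt) _ (words n n) ⟩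
    ∑[ g ∈ words n n ] (⟦ isAlt g ⟧ * ⟦ g ∈ᵇ C ⟧) ≡⟨ ∑-cong (words n n) inside ⟩
    ∑[ g ∈ words n n ] ⟦ g ∈ᵇ C ⟧                ≡⟨ ∑-cong (words n n) (λ g → ⟦∈ᵇ⟧≡∑ g unique) ⟩
    ∑[ g ∈ words n n ] ∑[ c ∈ C ] ⟦ g =ᵖ c ⟧     ≡⟨ ∑-comm _ (words n n) C ⟩
    ∑[ c ∈ C ] ∑[ g ∈ words n n ] ⟦ g =ᵖ c ⟧     ≡⟨ ∑-cong C (∑-words-≡ n n) ⟩
    ∑[ c ∈ C ] 1                                  ≡⟨ length≡∑1 C ⟨
    length C                                      ∎
    where
    open ≡-Reasoning
    inside : ∀ g → ⟦ isAlt g ⟧ * ⟦ g ∈ᵇ C ⟧ ≡ ⟦ g ∈ᵇ C ⟧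
    inside g with g ∈ᵇ C in g∈C
    ... | false = *-zeroʳ ⟦ isAlt g ⟧
    ... | true  = cong (λ b → ⟦ b ⟧ * 1) (T⇒true (C⊆Alt (∈ᵇ⇒∈ g C (true⇒T g∈C))))

-- Defs lists the coset ⟨γ⟩x as γʲx for j < |Aₙ|; as γ³ = 1 and 3 ≤ |Aₙ|, these are exactly
-- the elements of the orbit x, γx, γ²x.
module Orbit (m : ℕ) (s : Fin (suc m)) (3≤|G| : 3 ≤ length (Alt (3 + m))) where

  open ThreeCycle m s
  open GGraph (threeCycle m) using (G; coset; sameCoset; reps)

  orbit : Perm (3 + m) → List (Perm (3 + m))
  orbit x = x ∷ γ · x ∷ γ · (γ · x) ∷ []

  module _ {x : Perm (3 + m)} where

    γ·-∈-orbit : ∀ {g} → g ∈ orbit x → γ · g ∈ orbit x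
    γ·-∈-orbit (here refl)                 = there (here refl)
    γ·-∈-orbit (there (here refl))         = there (there (here refl))
    γ·-∈-orbit (there (there (here refl))) = here (γ·γ·γ· x)

    power-suc : ∀ j → (γ ^^ suc j) · x ≡ γ · ((γ ^^ j) · x)
    power-suc j = ·-assoc γ (γ ^^ j) x

    power-∈-orbit : ∀ j → (γ ^^ j) · x ∈ orbit x
    power-∈-orbit zero    = here (·-identityˡ x)
    power-∈-orbit (suc j) = subst (_∈ orbit x) (sym (power-suc j)) (γ·-∈-orbit (power-∈-orbit j))

    orbit-sym : ∀ {g} → g ∈ orbit x → x ∈ orbit g
    orbit-sym (here refl)                 = here refl
    orbit-sym (there (here refl))         = there (there (here (sym (γ·γ·γ· x))))
    orbit-sym (there (there (here refl))) = there (here (sym (γ·γ·γ· x)))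

    orbit-trans : ∀ {g h} → g ∈ orbit x → h ∈ orbit g → h ∈ orbit x
    orbit-trans g∈ (here refl)                 = g∈
    orbit-trans g∈ (there (here refl))         = γ·-∈-orbit g∈
    orbit-trans g∈ (there (there (here refl))) = γ·-∈-orbit (γ·-∈-orbit g∈)

    coset⇒orbit : ∀ {g} → g ∈ coset s x → g ∈ orbit x
    coset⇒orbit g∈ with ∈-map⁻ (λ j → (γ ^^ j) · x) g∈
    ... | j , _ , refl = power-∈-orbit j

    γ¹· : (γ ^^ 1) · x ≡ γ · x
    γ¹· = trans (power-suc 0) (cong (γ ·_) (·-identityˡ x))

    power-∈-coset : ∀ {j g} → j < 3 → (γ ^^ j) · x ≡ g → g ∈ coset s x
    power-∈-coset j<3 refl = ∈-map⁺ (λ j → (γ ^^ j) · x) (∈-upTo⁺ (≤-trans j<3 3≤|G|))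

    orbit⇒coset : ∀ {g} → g ∈ orbit x → g ∈ coset s x
    orbit⇒coset (here refl)                 = power-∈-coset (s≤s z≤n) (·-identityˡ x)
    orbit⇒coset (there (here refl))         = power-∈-coset (s≤s (s≤s z≤n)) γ¹·
    orbit⇒coset (there (there (here refl))) = power-∈-coset ≤-refl (trans (power-suc 1) (cong (γ ·_) γ¹·))

  isAlt-γ· : (x : Perm (3 + m)) → T (isAlt x) → T (isAlt (γ · x))
  isAlt-γ· x alt = Equivalence.from T-∧
    (Injective⇒isInjective (γ · x) (γ·-injective x inj) , subst T (sym (isEven-γ· x inj)) (proj₂ x-alt))
    where
    x-alt : T (isInjective x) × T (isEven x)
    x-alt = Equivalence.to T-∧ alt
    inj : Injective _≡_ _≡_ (lookup x)
    inj = isInjective⇒Injective x (proj₁ x-alt)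

  ∈G⇒isAlt : (x : Perm (3 + m)) → x ∈ G → T (isAlt x)
  ∈G⇒isAlt x x∈G = proj₂ (∈-filter⁻ (T? ∘ isAlt {3 + m}) {xs = words (3 + m) (3 + m)} x∈G)

  isAlt⇒Injective : (x : Perm (3 + m)) → T (isAlt x) → Injective _≡_ _≡_ (lookup x)
  isAlt⇒Injective x alt = isInjective⇒Injective x (proj₁ (Equivalence.to (T-∧ {isInjective x}) alt))

  orbit-unique : (x : Perm (3 + m)) → Injective _≡_ _≡_ (lookup x) → Unique (orbit x)
  orbit-unique x inj with γ-orbit-distinct x inj
  ... | x≢γx , x≢γγx , γx≢γγx =
    (x≢γx All.∷ x≢γγx All.∷ All.[]) ∷ (γx≢γγx All.∷ All.[]) ∷ All.[] ∷ []

  orbit⊆Alt : (x : Perm (3 + m)) → T (isAlt x) → ∀ {g} → g ∈ orbit x → T (isAlt g)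
  orbit⊆Alt x alt (here refl)                 = alt
  orbit⊆Alt x alt (there (here refl))         = isAlt-γ· x alt
  orbit⊆Alt x alt (there (there (here refl))) = isAlt-γ· (γ · x) (isAlt-γ· x alt)

  inOrbit : Perm (3 + m) → Perm (3 + m) → Bool
  inOrbit x g = g ∈ᵇ orbit x

  ∑-orbit : ∀ {x : Perm (3 + m)} → x ∈ G → ∑[ g ∈ G ] ⟦ inOrbit x g ⟧ ≡ 3
  ∑-orbit {x} x∈G = ∑-Alt-∈ᵇ (orbit x) (orbit-unique x (isAlt⇒Injective x alt)) (orbit⊆Alt x alt)
    where
    alt : T (isAlt x)
    alt = ∈G⇒isAlt x x∈G

  ∈ᵇ-coset : (x g : Perm (3 + m)) → (g ∈ᵇ coset s x) ≡ inOrbit x g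
  ∈ᵇ-coset x g = T-ext (∈⇒∈ᵇ g (orbit x) ∘ coset⇒orbit ∘ ∈ᵇ⇒∈ g (coset s x))
                       (∈⇒∈ᵇ g (coset s x) ∘ orbit⇒coset ∘ ∈ᵇ⇒∈ g (orbit x))

  inOrbit-sym : ∀ (x g : Perm (3 + m)) → T (inOrbit x g) → T (inOrbit g x)
  inOrbit-sym x g = ∈⇒∈ᵇ x (orbit g) ∘ orbit-sym ∘ ∈ᵇ⇒∈ g (orbit x)

  inOrbit-trans : ∀ (x g h : Perm (3 + m)) → T (inOrbit x g) → T (inOrbit g h) → T (inOrbit x h)
  inOrbit-trans x g h xg gh = ∈⇒∈ᵇ h (orbit x) (orbit-trans (∈ᵇ⇒∈ g (orbit x) xg) (∈ᵇ⇒∈ h (orbit g) gh))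

  inOrbit-refl : ∀ (x : Perm (3 + m)) → T (inOrbit x x)
  inOrbit-refl x = ∈⇒∈ᵇ x (orbit x) (here refl)

  sameCoset≡inOrbit : ∀ (x : Perm (3 + m)) {y} → y ∈ G → sameCoset s x y ≡ inOrbit x y
  sameCoset≡inOrbit x {y} y∈G = T-ext same⇒orbit orbit⇒same
    where
    same⇒orbit : T (sameCoset s x y) → T (inOrbit x y)
    same⇒orbit same = subst T (trans (sym (∈ᵇ-coset y y)) (trans (sym agree) (∈ᵇ-coset x y))) (inOrbit-refl y)
      where
      agree : (y ∈ᵇ coset s x) ≡ (y ∈ᵇ coset s y)
      agree = does-sound (_ ≟𝔹 _) (All.lookup (all⁺ _ G same) y∈G)
    orbit⇒same : T (inOrbit x y) → T (sameCoset s x y)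
    orbit⇒same xy = all⁻ _ {xs = G} (All.tabulate (λ {g} _ → does-complete (_ ≟𝔹 _) (agree g)))
      where
      agree : ∀ g → (g ∈ᵇ coset s x) ≡ (g ∈ᵇ coset s y)
      agree g = trans (∈ᵇ-coset x g)
        (trans (T-ext (inOrbit-trans y x g (inOrbit-sym x y xy)) (inOrbit-trans x y g xy)) (sym (∈ᵇ-coset y g)))

  reps⊆G : ∀ {r} → r ∈ reps s → r ∈ G
  reps⊆G = ∈-deduplicate⁻ _ G

  ∑-reps : ∀ {g} → g ∈ G → ∑[ r ∈ reps s ] ⟦ inOrbit r g ⟧ ≡ 1
  ∑-reps {g} g∈G = begin
    ∑[ r ∈ reps s ] ⟦ inOrbit r g ⟧
      ≡⟨ ∑-deduplicateᵇ inOrbit (λ {a} {b} → inOrbit-sym a b) (λ {a} {b} {c} → inOrbit-trans a b c)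
                        (sameCoset s) G sameCoset≡inOrbit g ⟩
    ⟦ any (λ l → inOrbit l g) G ⟧
      ≡⟨ cong ⟦_⟧ (T⇒true (any⁺ _ (Any.map (λ { refl → inOrbit-refl g }) g∈G))) ⟩
    1 ∎
    where open ≡-Reasoning

  3*|reps|≡|G| : 3 * length (reps s) ≡ length G
  3*|reps|≡|G| = begin
    3 * length (reps s)                          ≡⟨ ∑-const 3 (reps s) ⟨
    ∑[ r ∈ reps s ] 3                             ≡⟨ ∑-cong-∈ (reps s) (λ _ r∈reps → sym (∑-orbit (reps⊆G r∈reps))) ⟩
    ∑[ r ∈ reps s ] ∑[ g ∈ G ] ⟦ inOrbit r g ⟧    ≡⟨ ∑-comm _ (reps s) G ⟩
    ∑[ g ∈ G ] ∑[ r ∈ reps s ] ⟦ inOrbit r g ⟧    ≡⟨ ∑-cong-∈ G (λ g → ∑-reps) ⟩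
    ∑[ g ∈ G ] 1                                  ≡⟨ length≡∑1 G ⟨
    length G                                      ∎
    where open ≡-Reasoning

-- The G-graph Γ(Aₙ, S)

6≤n! : ∀ m → 6 ≤ (3 + m) !
6≤n! zero    = ≤-refl
6≤n! (suc m) = ≤-trans (6≤n! m) (m≤n*m ((3 + m) !) (4 + m))

module Γ (m : ℕ) where

  open GGraph (threeCycle m) hiding (_∈ᵇ_)

  2*|G|≡n! : 2 * length G ≡ (3 + m) !
  2*|G|≡n! = 2*|Alt|≡n! (suc m)

  3≤|G| : 3 ≤ length G
  3≤|G| = *-cancelˡ-≤ 2 (subst (6 ≤_) (sym 2*|G|≡n!) (6≤n! m))

  module O (s : Fin (suc m)) = Orbit m s 3≤|G|
  open O using (inOrbit)

  meet≡∑ : ∀ s x t y → meet s x t y ≡ ∑[ g ∈ G ] (⟦ inOrbit s x g ⟧ * ⟦ inOrbit t y g ⟧)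
  meet≡∑ s x t y = trans (length-filterᵇ _ G) (∑-cong G λ g →
    trans (⟦∧⟧ (g ∈ᵇ coset s x) (g ∈ᵇ coset t y)) (cong₂ (λ a b → ⟦ a ⟧ * ⟦ b ⟧) (O.∈ᵇ-coset s x g) (O.∈ᵇ-coset t y g)))

  ∑-meet : ∀ s {x} t → x ∈ G → ∑[ y ∈ reps t ] meet s x t y ≡ 3
  ∑-meet s {x} t x∈G = begin
    ∑[ y ∈ reps t ] meet s x t y
      ≡⟨ ∑-cong (reps t) (meet≡∑ s x t) ⟩
    ∑[ y ∈ reps t ] ∑[ g ∈ G ] (⟦ inOrbit s x g ⟧ * ⟦ inOrbit t y g ⟧)
      ≡⟨ ∑-comm _ (reps t) G ⟩
    ∑[ g ∈ G ] ∑[ y ∈ reps t ] (⟦ inOrbit s x g ⟧ * ⟦ inOrbit t y g ⟧)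
      ≡⟨ ∑-cong-∈ G (λ g g∈G → trans (∑-*ˡ ⟦ inOrbit s x g ⟧ _ (reps t))
                                      (trans (cong (⟦ inOrbit s x g ⟧ *_) (O.∑-reps t g∈G)) (*-identityʳ _))) ⟩
    ∑[ g ∈ G ] ⟦ inOrbit s x g ⟧
      ≡⟨ O.∑-orbit s x∈G ⟩
    3 ∎
    where open ≡-Reasoning

  ∑-mult : ∀ s {x} t → (s =ᶠ t) ≡ false → x ∈ G → ∑[ y ∈ reps t ] mult s x t y ≡ 3
  ∑-mult s {x} t s≢t x∈G =
    trans (∑-cong (reps t) (λ y → cong (if_then 0 else meet s x t y) s≢t)) (∑-meet s t x∈G)

  mult-within-class : ∀ s x y → mult s x s y ≡ 0
  mult-within-class s x y = cong (if_then 0 else meet s x s y) (T⇒true (does-complete (s ≟ s) refl))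

  ∑-others : ∀ (s : Fin (suc m)) → ∑[ t ∈ allFin (suc m) ] ⟦ not (s =ᶠ t) ⟧ ≡ m
  ∑-others s = ℕ-suc-injective (begin
    suc others                                 ≡⟨ +-comm 1 others ⟩
    others + 1                                 ≡⟨ cong (others +_) itself ⟨
    others + ∑[ t ∈ allFin (suc m) ] ⟦ s =ᶠ t ⟧ ≡⟨ ∑-complement (s =ᶠ_) (allFin (suc m)) ⟩
    length (allFin (suc m))                    ≡⟨ length-allFin (suc m) ⟩
    suc m                                      ∎)
    where
    open ≡-Reasoning
    others : ℕ
    others = ∑[ t ∈ allFin (suc m) ] ⟦ not (s =ᶠ t) ⟧
    itself : ∑[ t ∈ allFin (suc m) ] ⟦ s =ᶠ t ⟧ ≡ 1
    itself = trans (∑-cong (allFin (suc m)) (λ t → cong ⟦_⟧ (=ᶠ-sym s t))) (∑-allFin-≟ s)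

  degree≡ : ∀ s x → x ∈ reps s → degree s x ≡ 3 * m
  degree≡ s x x∈reps = begin
    degree s x
      ≡⟨ ∑-cong (allFin (suc m)) (λ t → others t (s =ᶠ t) refl) ⟩
    ∑[ t ∈ allFin (suc m) ] (3 * ⟦ not (s =ᶠ t) ⟧)
      ≡⟨ ∑-*ˡ 3 (λ t → ⟦ not (s =ᶠ t) ⟧) (allFin (suc m)) ⟩
    3 * ∑[ t ∈ allFin (suc m) ] ⟦ not (s =ᶠ t) ⟧
      ≡⟨ cong (3 *_) (∑-others s) ⟩
    3 * m ∎
    where
    open ≡-Reasoning
    others : ∀ t b → (s =ᶠ t) ≡ b → ∑[ y ∈ reps t ] mult s x t y ≡ 3 * ⟦ not b ⟧
    others t true  s≡t =
      trans (∑-cong (reps t) (λ y → cong (if_then 0 else meet s x t y) s≡t)) (∑-zero (reps t))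
    others t false s≢t = ∑-mult s t s≢t (O.reps⊆G s x∈reps)

  pairs : ℕ
  pairs = ∑² (λ (s t : Fin (suc m)) → ⟦ s <ᶠ t ⟧)

  2*pairs : 2 * pairs ≡ suc m * m
  2*pairs = +-cancelʳ-≡ (suc m) (2 * pairs) (suc m * m) (begin
    2 * pairs + suc m
      ≡⟨ cong₂ _+_ (*-comm pairs 2) (∑-allFin-1 (suc m)) ⟨
    pairs * 2 + ∑[ s ∈ allFin (suc m) ] 1
      ≡⟨ cong (_+ ∑[ s ∈ allFin (suc m) ] 1) (∑²-*ʳ 2 (λ (s t : Fin (suc m)) → ⟦ s <ᶠ t ⟧)) ⟨
    ∑² (λ (s t : Fin (suc m)) → ⟦ s <ᶠ t ⟧ * (1 + 1)) + ∑[ s ∈ allFin (suc m) ] 1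
      ≡⟨ ∑²-triangles (λ (_ _ : Fin (suc m)) → 1) ⟩
    ∑² (λ (s t : Fin (suc m)) → 1)
      ≡⟨ ∑-cong (allFin (suc m)) (λ _ → ∑-allFin-1 (suc m)) ⟩
    ∑[ s ∈ allFin (suc m) ] suc m
      ≡⟨ trans (∑-const (suc m) (allFin (suc m))) (cong (suc m *_) (length-allFin (suc m))) ⟩
    suc m * suc m
      ≡⟨ *-suc (suc m) m ⟩
    suc m + suc m * m
      ≡⟨ +-comm (suc m) _ ⟩
    suc m * m + suc m ∎)
    where open ≡-Reasoning

  edgeCount≡ : edgeCount ≡ pairs * length G
  edgeCount≡ = begin
    edgeCount                                          ≡⟨ ∑²-cong (λ s t → class-pair s t (toℕ s <ᵇ toℕ t) refl) ⟩
    ∑² (λ (s t : Fin (suc m)) → ⟦ s <ᶠ t ⟧ * length G) ≡⟨ ∑²-*ʳ (length G) (⟦_<ᶠ_⟧ {suc m}) ⟩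
    pairs * length G                                   ∎
    where
    open ≡-Reasoning
    class-pair : ∀ s t b → (toℕ s <ᵇ toℕ t) ≡ b →
      (if b then ∑[ x ∈ reps s ] ∑[ y ∈ reps t ] mult s x t y else 0) ≡ ⟦ b ⟧ * length G
    class-pair s t false _    = refl
    class-pair s t true  s<t = begin
      ∑[ x ∈ reps s ] ∑[ y ∈ reps t ] mult s x t y   ≡⟨ ∑-cong-∈ (reps s) (λ _ x∈reps → ∑-mult s t s≢t (O.reps⊆G s x∈reps)) ⟩
      ∑[ x ∈ reps s ] 3                              ≡⟨ ∑-const 3 (reps s) ⟩
      3 * length (reps s)                            ≡⟨ O.3*|reps|≡|G| s ⟩
      length G                                       ≡⟨ +-identityʳ (length G) ⟨
      1 * length G                                   ∎
      where
      s≢t : (s =ᶠ t) ≡ false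
      s≢t with s ≟ t
      ... | no  _    = refl
      ... | yes refl = case trans (sym s<t) (<ᵇ-irrefl (toℕ s)) of λ ()

  4*edgeCount : 4 * edgeCount ≡ (3 + m) ! * suc m * m
  4*edgeCount = begin
    4 * edgeCount                      ≡⟨ cong (4 *_) edgeCount≡ ⟩
    4 * (pairs * length G)             ≡⟨ regroup pairs (length G) ⟩
    (2 * length G) * (2 * pairs)       ≡⟨ cong₂ _*_ 2*|G|≡n! 2*pairs ⟩
    (3 + m) ! * (suc m * m)            ≡⟨ *-assoc ((3 + m) !) (suc m) m ⟨
    (3 + m) ! * suc m * m              ∎
    where
    open ≡-Reasoning
    regroup : ∀ p g → 4 * (p * g) ≡ (2 * g) * (2 * p)
    regroup = solve-∀

  6*vertexCount : 6 * vertexCount ≡ (3 + m) ! * suc m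
  6*vertexCount = begin
    6 * vertexCount                                    ≡⟨ ∑-*ˡ 6 (λ s → length (reps s)) (allFin (suc m)) ⟨
    ∑[ s ∈ allFin (suc m) ] (6 * length (reps s))      ≡⟨ ∑-cong (allFin (suc m)) class-size ⟩
    ∑[ s ∈ allFin (suc m) ] ((3 + m) !)                ≡⟨ ∑-const ((3 + m) !) (allFin (suc m)) ⟩
    (3 + m) ! * length (allFin (suc m))                ≡⟨ cong ((3 + m) ! *_) (length-allFin (suc m)) ⟩
    (3 + m) ! * suc m                                  ∎
    where
    open ≡-Reasoning
    class-size : ∀ s → 6 * length (reps s) ≡ (3 + m) !
    class-size s = trans (*-assoc 2 3 (length (reps s))) (trans (cong (2 *_) (O.3*|reps|≡|G| s)) 2*|G|≡n!)

theorem4p7p2 : (m : ℕ) → let n = 3 + m in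
    let open GGraph (threeCycle m) in
    ((s : Fin (n ∸ 2)) (x y : Perm n) → x ∈ reps s → y ∈ reps s → mult s x s y ≡ 0)
    × ((s : Fin (n ∸ 2)) (x : Perm n) → x ∈ reps s → degree s x ≡ 3 * (n ∸ 3))
    × (4 * edgeCount ≡ n ! * (n ∸ 2) * (n ∸ 3))
    × (6 * vertexCount ≡ n ! * (n ∸ 2))
theorem4p7p2 m = (λ s x y _ _ → mult-within-class s x y) , degree≡ , 4*edgeCount , 6*vertexCount
  where open Γ m
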